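{- Let $H$ be the set of formulas built from a set of propositional variables and the constants $0,1$ by the binary connective $\wedge$ and the unary connective $\neg$. Let $\le$ be the smallest relation on $H$ such that for all formulas $a,b,c$: $a\le a$; $0\le a\le 1$; $a\le c, c\le b\Rightarrow a\le b$; $c\le a, c\le b\Rightarrow c\le a\wedge b$; $c\le a\wedge b\Rightarrow c\le a$; $c\le a\wedge b\Rightarrow c\le b$; $a\wedge b\le 0\Rightarrow a\le\neg b$; $a\le\neg b\Rightarrow a\wedge b\le 0$. Then the calculus is consistent: there is no formula $a$ with both $1\le a$ and $a\le 0$. Moreover, the relation $a\le b$ on $H$ is decidable. -}

module Defs where

open import Level using (Level)
open import Relation.Binary.Definitions using (DecidableEquality)

data Form {ℓ : Level} (V : Set ℓ) : Set ℓ where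
  var  : V → Form V
  𝟘 𝟙  : Form V
  _∧_  : Form V → Form V → Form V
  neg  : Form V → Form V

infixr 6 _∧_
infix  4 _≤_

data _≤_ {ℓ : Level} {V : Set ℓ} : Form V → Form V → Set ℓ where
  refl≤  : ∀ {a} → a ≤ a
  zero≤  : ∀ {a} → 𝟘 ≤ a
  ≤one   : ∀ {a} → a ≤ 𝟙
  trans≤ : ∀ {a b c} → a ≤ c → c ≤ b → a ≤ b
  ∧-intro : ∀ {a b c} → c ≤ a → c ≤ b → c ≤ a ∧ b
  ∧-elimˡ : ∀ {a b c} → c ≤ a ∧ b → c ≤ a
  ∧-elimʳ : ∀ {a b c} → c ≤ a ∧ b → c ≤ b
  ¬-intro : ∀ {a b} → a ∧ b ≤ 𝟘 → a ≤ neg b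
  ¬-elim  : ∀ {a b} → a ≤ neg b → a ∧ b ≤ 𝟘

-- Consistency is soundness for two-valued valuations: 𝟙 ≤ 𝟘 fails in Bool.
--
-- Decidability goes by recursion on the right-hand side.  The cases 𝟙, b ∧ c
-- and ¬ c (via a ∧ c ≤ 𝟘) are immediate from the rules, so two facts remain:
--   * a ≤ 𝟘 holds iff a is classically unsatisfiable (a Glivenko-style
--     completeness).  The derivation is found by Kalmár's lemma — under
--     literals fixing the variables of φ, the calculus proves φ or ¬ φ
--     according to its truth value — combined with cuts on the variables.
--   * a ≤ var p holds iff var p is a top-level conjunct of a or a ≤ 𝟘.  For a
--     satisfiable a without that conjunct, a two-world Kripke model refutes
--     a ≤ var p: at the root exactly the top-level conjuncts of a hold, while
--     the only successor is a classical valuation satisfying a.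
module Submission where

open import Defs
open import Level using (Level; Lift; lift)
open import Data.Bool using (Bool; true; false; not; T) renaming (_∧_ to _&&_)
open import Data.Bool.Properties using (T-∧)
open import Data.Empty using (⊥; ⊥-elim)
import Data.Empty.Polymorphic as Poly
import Data.Unit.Polymorphic as Poly
open import Data.List using (List; []; _∷_; _++_)
open import Data.List.Membership.Propositional using (_∈_)
open import Data.List.Membership.Propositional.Properties using (∈-++⁺ˡ; ∈-++⁺ʳ)
open import Data.List.Relation.Unary.Any using (here; there)
open import Data.Product using (_×_; ∃-syntax; _,_; proj₁; proj₂)
open import Data.Sum using (_⊎_; inj₁; inj₂)
open import Function.Bundles using (Equivalence)
open import Relation.Nullary using (¬_; Dec; yes; no)
open import Relation.Binary.Definitions using (DecidableEquality)
open import Relation.Binary.PropositionalEquality using (refl; sym)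

open Equivalence using (to; from)

module _ {ℓ : Level} {V : Set ℓ} where

  ∧-fst : ∀ {a b : Form V} → a ∧ b ≤ a
  ∧-fst = ∧-elimˡ refl≤

  ∧-snd : ∀ {a b : Form V} → a ∧ b ≤ b
  ∧-snd = ∧-elimʳ refl≤

  contradict : ∀ {a c : Form V} → c ≤ a → c ≤ neg a → c ≤ 𝟘
  contradict c≤a c≤¬a = trans≤ (∧-intro refl≤ c≤a) (¬-elim c≤¬a)

  cut : ∀ {c x : Form V} → c ∧ x ≤ 𝟘 → c ∧ neg x ≤ 𝟘 → c ≤ 𝟘
  cut c∧x≤𝟘 c∧¬x≤𝟘 = trans≤ (∧-intro refl≤ (¬-intro c∧x≤𝟘)) c∧¬x≤𝟘

  ¬𝟘 : ∀ {c : Form V} → c ≤ neg 𝟘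
  ¬𝟘 = ¬-intro ∧-snd

  ¬¬-intro : ∀ {a c : Form V} → c ≤ a → c ≤ neg (neg a)
  ¬¬-intro c≤a = ¬-intro (trans≤ (∧-intro ∧-snd (trans≤ ∧-fst c≤a)) (¬-elim refl≤))

  ¬∧ˡ : ∀ {a b c : Form V} → c ≤ neg a → c ≤ neg (a ∧ b)
  ¬∧ˡ c≤¬a = ¬-intro (trans≤ (∧-intro ∧-fst (trans≤ ∧-snd ∧-fst)) (¬-elim c≤¬a))

  ¬∧ʳ : ∀ {a b c : Form V} → c ≤ neg b → c ≤ neg (a ∧ b)
  ¬∧ʳ c≤¬b = ¬-intro (trans≤ (∧-intro ∧-fst (trans≤ ∧-snd ∧-snd)) (¬-elim c≤¬b))

  eval : (V → Bool) → Form V → Bool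
  eval v (var q) = v q
  eval v 𝟘       = false
  eval v 𝟙       = true
  eval v (a ∧ b) = eval v a && eval v b
  eval v (neg a) = not (eval v a)

  _⊨_ : (V → Bool) → Form V → Set
  v ⊨ a = T (eval v a)

  Satisfiable : Form V → Set ℓ
  Satisfiable a = ∃[ v ] v ⊨ a

  not-intro : ∀ x → (T x → ⊥) → T (not x)
  not-intro false _  = _
  not-intro true  ¬x = ¬x _

  not-elim : ∀ x → T (not x) → T x → ⊥
  not-elim false _ ()

  sound : ∀ {a b : Form V} → a ≤ b → ∀ v → v ⊨ a → v ⊨ b
  sound refl≤         v ⊨a = ⊨a
  sound zero≤         v ()
  sound ≤one          v ⊨a = _
  sound (trans≤ p q)  v ⊨a = sound q v (sound p v ⊨a)
  sound (∧-intro p q) v ⊨a = from T-∧ (sound p v ⊨a , sound q v ⊨a)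
  sound (∧-elimˡ p)   v ⊨a = to T-∧ (sound p v ⊨a) .proj₁
  sound (∧-elimʳ p)   v ⊨a = to T-∧ (sound p v ⊨a) .proj₂
  sound (¬-intro {b = b} p) v ⊨a =
    not-intro (eval v b) (λ ⊨b → sound p v (from T-∧ (⊨a , ⊨b)))
  sound (¬-elim {b = b} p) v ⊨a∧b with to T-∧ ⊨a∧b
  ... | ⊨a , ⊨b = not-elim (eval v b) (sound p v ⊨a) ⊨b

  satisfiable⇒¬≤𝟘 : ∀ {a : Form V} → Satisfiable a → ¬ (a ≤ 𝟘)
  satisfiable⇒¬≤𝟘 (v , ⊨a) a≤𝟘 = sound a≤𝟘 v ⊨a

  -- Forcing at the root of a two-world Kripke model: the atoms U hold at the
  -- root, the successor world is the classical valuation v.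
  module Root (U : V → Set ℓ) (v : V → Bool) (persist : ∀ {q} → U q → v ⊨ var q) where

    _⊩ : Form V → Set ℓ
    var q ⊩   = U q
    𝟘 ⊩       = Poly.⊥
    𝟙 ⊩       = Poly.⊤
    (a ∧ b) ⊩ = a ⊩ × b ⊩
    neg a ⊩   = Lift ℓ (v ⊨ neg a)

    monotone : ∀ φ → φ ⊩ → v ⊨ φ
    monotone (var q) ⊩q        = persist ⊩q
    monotone 𝟘       ()
    monotone 𝟙       _         = _
    monotone (a ∧ b) (⊩a , ⊩b) = from T-∧ (monotone a ⊩a , monotone b ⊩b)
    monotone (neg a) (lift ⊨¬a) = ⊨¬a

    sound-root : ∀ {a b : Form V} → a ≤ b → a ⊩ → b ⊩
    sound-root refl≤         ⊩a = ⊩a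
    sound-root zero≤         ()
    sound-root ≤one          ⊩a = _
    sound-root (trans≤ p q)  ⊩a = sound-root q (sound-root p ⊩a)
    sound-root (∧-intro p q) ⊩a = sound-root p ⊩a , sound-root q ⊩a
    sound-root (∧-elimˡ p)   ⊩a = sound-root p ⊩a .proj₁
    sound-root (∧-elimʳ p)   ⊩a = sound-root p ⊩a .proj₂
    sound-root (¬-intro {a} p) ⊩a = lift (sound (¬-intro p) v (monotone a ⊩a))
    sound-root (¬-elim {a} {b} p) ⊩a∧b =
      ⊥-elim (sound (¬-elim p) v (monotone (a ∧ b) ⊩a∧b))

  data Conjunct (q : V) : Form V → Set ℓ where
    this  : Conjunct q (var q)
    left  : ∀ {a b} → Conjunct q a → Conjunct q (a ∧ b)
    right : ∀ {a b} → Conjunct q b → Conjunct q (a ∧ b)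

  conjunct-≤ : ∀ {q a} → Conjunct q a → a ≤ var q
  conjunct-≤ this      = refl≤
  conjunct-≤ (left c)  = trans≤ ∧-fst (conjunct-≤ c)
  conjunct-≤ (right c) = trans≤ ∧-snd (conjunct-≤ c)

  conjunct-true : ∀ v {a} → v ⊨ a → ∀ {q} → Conjunct q a → v ⊨ var q
  conjunct-true v ⊨a this      = ⊨a
  conjunct-true v ⊨a (left c)  = conjunct-true v (to T-∧ ⊨a .proj₁) c
  conjunct-true v ⊨a (right c) = conjunct-true v (to T-∧ ⊨a .proj₂) c

  module ConjunctModel (a : Form V) (v : V → Bool) (⊨a : v ⊨ a) where
    open Root (λ q → Conjunct q a) v (conjunct-true v ⊨a) public

    forced : ∀ φ → (∀ {q} → Conjunct q φ → Conjunct q a) → v ⊨ φ → φ ⊩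
    forced (var q) sub ⊨φ = sub this
    forced 𝟘       sub ()
    forced 𝟙       sub ⊨φ = _
    forced (φ ∧ ψ) sub ⊨φ∧ψ with to T-∧ ⊨φ∧ψ
    ... | ⊨φ , ⊨ψ = forced φ (λ c → sub (left c)) ⊨φ , forced ψ (λ c → sub (right c)) ⊨ψ
    forced (neg φ) sub ⊨¬φ = lift ⊨¬φ

  ≤var⇒conjunct : ∀ {a p} → Satisfiable a → a ≤ var p → Conjunct p a
  ≤var⇒conjunct {a} (v , ⊨a) a≤p = sound-root a≤p (forced a (λ c → c) ⊨a)
    where open ConjunctModel a v ⊨a

  lit : Form V → Bool → Form V
  lit φ true  = φ
  lit φ false = neg φ

  vars : Form V → List V
  vars (var q) = q ∷ []
  vars 𝟘       = []
  vars 𝟙       = []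
  vars (a ∧ b) = vars a ++ vars b
  vars (neg a) = vars a

  kalmar : ∀ {c} v φ → (∀ {q} → q ∈ vars φ → c ≤ lit (var q) (v q)) →
           c ≤ lit φ (eval v φ)
  kalmar v (var q) lits = lits (here refl)
  kalmar v 𝟘       lits = ¬𝟘
  kalmar v 𝟙       lits = ≤one
  kalmar v (φ ∧ ψ) lits
    with eval v φ | kalmar v φ (λ m → lits (∈-++⁺ˡ m))
       | eval v ψ | kalmar v ψ (λ m → lits (∈-++⁺ʳ (vars φ) m))
  ... | true  | c≤φ  | true  | c≤ψ  = ∧-intro c≤φ c≤ψ
  ... | false | c≤¬φ | _     | _    = ¬∧ˡ c≤¬φ
  ... | true  | _    | false | c≤¬ψ = ¬∧ʳ c≤¬ψ
  kalmar v (neg φ) lits with eval v φ | kalmar v φ lits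
  ... | true  | c≤φ  = ¬¬-intro c≤φ
  ... | false | c≤¬φ = c≤¬φ

  lit-cases : ∀ {a c} b → c ≤ a → c ≤ lit a b → T b ⊎ c ≤ 𝟘
  lit-cases true  _   _    = inj₁ _
  lit-cases false c≤a c≤¬a = inj₂ (contradict c≤a c≤¬a)

module _ {ℓ : Level} {V : Set ℓ} (_≟_ : DecidableEquality V) where

  conjunct? : ∀ p (a : Form V) → Dec (Conjunct p a)
  conjunct? p (var q) with p ≟ q
  ... | yes refl = yes this
  ... | no p≢q   = no λ { this → p≢q refl }
  conjunct? p 𝟘 = no λ ()
  conjunct? p 𝟙 = no λ ()
  conjunct? p (a ∧ b) with conjunct? p a | conjunct? p b
  ... | yes c  | _      = yes (left c)
  ... | no _   | yes c  = yes (right c)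
  ... | no ¬cₗ | no ¬cᵣ = no λ { (left c) → ¬cₗ c ; (right c) → ¬cᵣ c }
  conjunct? p (neg a) = no λ ()

  _[_≔_] : (V → Bool) → V → Bool → V → Bool
  (v [ p ≔ b ]) q with p ≟ q
  ... | yes _ = b
  ... | no _  = v q

  module Refute (a : Form V) where

    -- Invariant of the search: every variable of a is still to be split
    -- (in ps), or c proves its literal under the current valuation v.
    Fixed : List V → Form V → (V → Bool) → Set ℓ
    Fixed ps c v = ∀ {q} → q ∈ vars a → q ∈ ps ⊎ c ≤ lit (var q) (v q)

    assign : ∀ {p ps c v} b → Fixed (p ∷ ps) c v →
             Fixed ps (c ∧ lit (var p) b) (v [ p ≔ b ])
    assign {p} b fixed {q} m with p ≟ q
    ... | yes refl = inj₂ ∧-snd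
    ... | no p≢q with fixed m
    ...   | inj₁ (here q≡p)  = ⊥-elim (p≢q (sym q≡p))
    ...   | inj₁ (there m′)  = inj₁ m′
    ...   | inj₂ c≤lit       = inj₂ (trans≤ ∧-fst c≤lit)

    search : ∀ ps c v → c ≤ a → Fixed ps c v → c ≤ 𝟘 ⊎ Satisfiable a
    search [] c v c≤a fixed with lit-cases (eval v a) c≤a (kalmar v a lits)
      where
        lits : ∀ {q} → q ∈ vars a → c ≤ lit (var q) (v q)
        lits m with fixed m
        ... | inj₂ c≤lit = c≤lit
    ... | inj₁ ⊨a  = inj₂ (v , ⊨a)
    ... | inj₂ c≤𝟘 = inj₁ c≤𝟘
    search (p ∷ ps) c v c≤a fixed
      with search ps _ _ (trans≤ ∧-fst c≤a) (assign true fixed)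
         | search ps _ _ (trans≤ ∧-fst c≤a) (assign false fixed)
    ... | inj₂ sat | _        = inj₂ sat
    ... | inj₁ _   | inj₂ sat = inj₂ sat
    ... | inj₁ c∧p≤𝟘 | inj₁ c∧¬p≤𝟘 = inj₁ (cut c∧p≤𝟘 c∧¬p≤𝟘)

  refutable-or-satisfiable : ∀ a → a ≤ 𝟘 ⊎ Satisfiable a
  refutable-or-satisfiable a =
    Refute.search a (vars a) a (λ _ → false) refl≤ inj₁

  refutable? : ∀ (a : Form V) → Dec (a ≤ 𝟘)
  refutable? a with refutable-or-satisfiable a
  ... | inj₁ a≤𝟘 = yes a≤𝟘
  ... | inj₂ sat = no (satisfiable⇒¬≤𝟘 sat)

  ≤var? : ∀ (a : Form V) p → Dec (a ≤ var p)
  ≤var? a p with conjunct? p a | refutable-or-satisfiable a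
  ... | yes c  | _        = yes (conjunct-≤ c)
  ... | no _   | inj₁ a≤𝟘 = yes (trans≤ a≤𝟘 zero≤)
  ... | no ¬c  | inj₂ sat = no λ a≤p → ¬c (≤var⇒conjunct sat a≤p)

  _≤?_ : (a b : Form V) → Dec (a ≤ b)
  a ≤? var p = ≤var? a p
  a ≤? 𝟘     = refutable? a
  a ≤? 𝟙     = yes ≤one
  a ≤? (b ∧ c) with a ≤? b | a ≤? c
  ... | yes a≤b | yes a≤c = yes (∧-intro a≤b a≤c)
  ... | no a≰b  | _       = no λ a≤b∧c → a≰b (∧-elimˡ a≤b∧c)
  ... | yes _   | no a≰c  = no λ a≤b∧c → a≰c (∧-elimʳ a≤b∧c)
  a ≤? neg c with refutable? (a ∧ c)
  ... | yes a∧c≤𝟘 = yes (¬-intro a∧c≤𝟘)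
  ... | no a∧c≰𝟘  = no λ a≤¬c → a∧c≰𝟘 (¬-elim a≤¬c)

consistent : ∀ {ℓ} {V : Set ℓ} → ¬ (∃[ a ] (𝟙 ≤ a × a ≤ (𝟘 {V = V})))
consistent (a , 𝟙≤a , a≤𝟘) = sound (trans≤ 𝟙≤a a≤𝟘) (λ _ → false) _

mainTheorem11 : ∀ {ℓ : Level} {V : Set ℓ} → DecidableEquality V →
    (¬ (∃[ a ] (𝟙 ≤ a × a ≤ (𝟘 {V = V})))) × ((a b : Form V) → Dec (a ≤ b))
mainTheorem11 _≟_ = consistent , _≤?_ _≟_
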